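{- Let $\mathcal M=(M,\le,{}^\perp)$ be a complete orthomodular lattice and let $L_{\mathcal M}=\mathscr T(\mathbf{Lin}(\mathcal M))$. Then $(\mathscr P(L_{\mathcal M}),\bigcup,\odot,{}^*,{\sim},\{\mathrm{id}_M\})$ is a $\mathscr T$-based orthomodular dynamic algebra.
   Context: A unital involutive quantale $(K,\bigsqcup,\odot,{}^*,e)$: complete join-semilattice (binary join $\sqcup$), associative $\odot$ distributing over arbitrary joins on both sides, unit $e$, involution with $x^{**}=x$, $(x\odot y)^*=y^*\odot x^*$, $(\bigsqcup x_i)^*=\bigsqcup x_i^*$. An involutive generalized dynamic algebra (IDA) is $(K,\bigsqcup,\odot,{}^*,{\sim},e)$ with such a quantale and ${\sim}:K\to K$ satisfying for all $x,y$ and families $(x_i)$: ${\sim}(x\odot{\sim}{\sim}y)={\sim}(x\odot y)$; ${\sim}(\bigsqcup_i{\sim}{\sim}x_i)={\sim}(\bigsqcup_ix_i)$; $({\sim}x)^*={\sim}x$; ${\sim}{\sim}({\sim}{\sim}x\odot y)={\sim}({\sim}x\sqcup{\sim}({\sim}x\sqcup y))$. Notation: $\widetilde K=\{{\sim}k\}$; $\bigvee W={\sim}{\sim}\bigsqcup W$; $k\preceq l$ iff $\bigvee\{k,l\}=l$; $w^\perp={\sim}w$; $k\bullet v={\sim}{\sim}(k\odot v)$; $k\equiv l$ iff $k\bullet w=l\bullet w$ for all $w\in\widetilde K$. IDA morphisms preserve arbitrary joins, $\odot$, unit, ${}^*$, ${\sim}$. Semi-Foulis: $(\widetilde K,\preceq,{}^\perp)$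 is a complete orthomodular lattice (OML). For a complete OML $\mathcal M$ with Sasaki projections $\pi_m(x)=m\wedge(m^\perp\vee x)$, $\mathbf{Lin}(\mathcal M)$ is the set of maps $f:M\to M$ admitting $f^*$ with $f(x)\le y^\perp\iff x\le f^*(y)^\perp$, with pointwise joins, $\odot=\circ$, involution $f^*$, unit $\mathrm{id}_M$, ${\sim}f=\pi_{f(1)^\perp}$ (an IDA with test set $\{\pi_m\}$). For an involutive submonoid $L\subseteq\mathbf{Lin}(\mathcal M)$ containing all $\pi_m$, $\mathscr P(L)$ is the IDA of subsets of $L$ with union, $A\odot B=\{a\circ b\}$, $A^*=\{a^*\}$, ${\sim}A=\{\pi_{(\bigvee_{a\in A}a(1))^\perp}\}$, unit $\{\mathrm{id}_M\}$. $\mathbb{IM}$: involutive monoids with maps preserving product, unit, involution. Fix a functor $\mathscr T$ from IDAs to $\mathbb{IM}$ with: (T1) $\widetilde K\subseteq\mathscr T(K)\subseteq K$, $\mathscr T(K)$ an involutive submonoid (so $\mathscr T(\mathbf{Lin}(\mathcal M))$ contains all $\pi_m$); (T2) for every semi-Foulis $\mathfrak K$ with $s=t\iff s\equiv t$ on $\mathscr T(K)$, $\nu_{\mathfrak K}(k)=k\bullet(-)$ is an $\mathbb{IM}$-isomorphism $\mathscr T(\mathfrak K)\to\mathscr T(\mathbf{Lin}(\widetilde K,\preceq,{}^\perp))$; (T3) for every complete OML $\mathcal M$, $f\mapsto\{f\}$ is an $\mathbb{IM}$-isomorphism $\mathscr T(\mathbf{Lin}(\mathcal M))\to\mathscr T(\mathscr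 P(\mathscr T(\mathbf{Lin}(\mathcal M))))$; (T4) $\mathscr T(f)$ is the restriction of $f$. A $\mathscr T$-based orthomodular dynamic algebra is an IDA with: (TODA1) $(\widetilde K,\preceq,{}^\perp)$ complete OML; (TODA2) any $A$ with $\mathscr T(K)\subseteq A\subseteq K$ closed under $\odot$, ${}^*$, arbitrary joins equals $K$; (TODA3) for $S,T\subseteq\mathscr T(K)$, $\bigsqcup S=\bigsqcup T$ iff $S=T$; (TODA4) for $s,t\in\mathscr T(K)$, $s=t$ iff $s\equiv t$. -}

module Defs where

open import Level using (Level; Lift; lift; Setω) renaming (suc to lsuc; _⊔_ to _⊔ˡ_)
open import Data.Bool.Base using (Bool; true; false)
open import Data.Empty using (⊥)
open import Data.Product using (Σ; _×_; _,_; proj₁; proj₂)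
open import Relation.Binary.Core using (Rel)
open import Relation.Binary.Structures using (IsEquivalence; IsPartialOrder)

infix 2 _⇔_
_⇔_ : ∀ {a b} → Set a → Set b → Set (a ⊔ˡ b)
A ⇔ B = (A → B) × (B → A)

pair : ∀ {ι a} {A : Set a} → A → A → Lift ι Bool → A
pair x y (lift true)  = x
pair x y (lift false) = y

empty : ∀ {ι a} {A : Set a} → Lift ι ⊥ → A
empty (lift ())

module LatticeOps {ι c} {A : Set c} (⋁ : {I : Set ι} → (I → A) → A) (_ᗮ : A → A) where
  join : A → A → A
  join x y = ⋁ (pair x y)

  bot : A
  bot = ⋁ empty

  top : A
  top = bot ᗮ

  meet : A → A → A
  meet x y = (join (x ᗮ) (y ᗮ)) ᗮ

  sasaki : A → A → A
  sasaki m x = meet m (join (m ᗮ) x)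

record IsCompleteOML (ι : Level) {c ℓ} {A : Set c}
                     (_≈_ : Rel A ℓ) (_≤_ : Rel A ℓ) (_ᗮ : A → A)
                     : Set (lsuc ι ⊔ˡ c ⊔ˡ ℓ) where
  field
    isPartialOrder : IsPartialOrder _≈_ _≤_
    ᗮ-cong         : ∀ {x y} → x ≈ y → (x ᗮ) ≈ (y ᗮ)
    ᗮ-involutive   : ∀ x → ((x ᗮ) ᗮ) ≈ x
    ᗮ-antitone     : ∀ {x y} → x ≤ y → (y ᗮ) ≤ (x ᗮ)
    ⋁              : {I : Set ι} → (I → A) → A
    ⋁-upper        : ∀ {I : Set ι} (f : I → A) (i : I) → f i ≤ ⋁ f
    ⋁-least        : ∀ {I : Set ι} (f : I → A) (u : A) → (∀ i → f i ≤ u) → ⋁ f ≤ u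
    ᗮ-complement   : ∀ x → LatticeOps.join ⋁ _ᗮ x (x ᗮ) ≈ LatticeOps.top ⋁ _ᗮ
    orthomodular   : ∀ {x y} → x ≤ y →
                     y ≈ LatticeOps.join ⋁ _ᗮ x (LatticeOps.meet ⋁ _ᗮ (x ᗮ) y)

record CompleteOML (ι c ℓ : Level) : Set (lsuc (ι ⊔ˡ c ⊔ˡ ℓ)) where
  field
    Carrier       : Set c
    _≈_           : Rel Carrier ℓ
    _≤_           : Rel Carrier ℓ
    _ᗮ            : Carrier → Carrier
    isCompleteOML : IsCompleteOML ι _≈_ _≤_ _ᗮ
  open IsCompleteOML isCompleteOML public
  open LatticeOps ⋁ _ᗮ public

-- Elementary OML facts needed to *define* Lin(M)

module OMLFacts {ι c ℓ} (N : CompleteOML ι c ℓ) where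
  open CompleteOML N
  open IsPartialOrder isPartialOrder using (refl; reflexive; trans; antisym; module Eq)

  swap : ∀ {a b} → a ≤ (b ᗮ) → b ≤ (a ᗮ)
  swap {a} {b} p = trans (reflexive (Eq.sym (ᗮ-involutive b))) (ᗮ-antitone p)

  join-l : ∀ {x y} → x ≤ join x y
  join-l {x} {y} = ⋁-upper (pair x y) (lift true)

  join-r : ∀ {x y} → y ≤ join x y
  join-r {x} {y} = ⋁-upper (pair x y) (lift false)

  join-least : ∀ {x y u} → x ≤ u → y ≤ u → join x y ≤ u
  join-least {x} {y} {u} p q = ⋁-least (pair x y) u λ { (lift true) → p ; (lift false) → q }

  meet-l : ∀ {x y} → meet x y ≤ x
  meet-l {x} {y} = trans (ᗮ-antitone join-l) (reflexive (ᗮ-involutive x))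

  meet-r : ∀ {x y} → meet x y ≤ y
  meet-r {x} {y} = trans (ᗮ-antitone join-r) (reflexive (ᗮ-involutive y))

  meet-greatest : ∀ {x y z} → z ≤ x → z ≤ y → z ≤ meet x y
  meet-greatest p q = swap (join-least (ᗮ-antitone p) (ᗮ-antitone q))

  bot-least : ∀ {x} → bot ≤ x
  bot-least {x} = ⋁-least empty x λ { (lift ()) }

  top-greatest : ∀ {x} → x ≤ top
  top-greatest = swap bot-least

  sasaki-⇒ : ∀ {m x z} → z ≤ m → x ≤ (z ᗮ) → sasaki m x ≤ (z ᗮ)
  sasaki-⇒ zm p = trans meet-r (join-least (ᗮ-antitone zm) p)

  sasaki-⇐ : ∀ {m x z} → z ≤ m → sasaki m x ≤ (z ᗮ) → x ≤ (z ᗮ)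
  sasaki-⇐ {m} {x} {z} zm p =
    trans join-r
      (trans (reflexive (orthomodular (join-l {m ᗮ} {x})))
        (join-least (ᗮ-antitone zm)
          (trans (meet-greatest (trans meet-l (reflexive (ᗮ-involutive m))) meet-r) p)))

  sasaki-adjoint : ∀ m x y → (sasaki m x ≤ (y ᗮ)) ⇔ (x ≤ (sasaki m y ᗮ))
  sasaki-adjoint m x y =
    (λ p → sasaki-⇐ meet-l (swap (sasaki-⇒ meet-l (swap p)))) ,
    (λ p → swap (sasaki-⇐ meet-l (swap (sasaki-⇒ meet-l p))))

  sasaki-mono : ∀ {m m' x} → m ≈ m' → sasaki m x ≤ sasaki m' x
  sasaki-mono eq =
    meet-greatest (trans meet-l (reflexive eq))
      (trans meet-r (join-least (trans (ᗮ-antitone (reflexive (Eq.sym eq))) join-l) join-r))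

  sasaki-cong : ∀ {m m'} x → m ≈ m' → sasaki m x ≈ sasaki m' x
  sasaki-cong x eq = antisym (sasaki-mono eq) (sasaki-mono (Eq.sym eq))

  sasaki-top : ∀ n → sasaki n top ≈ n
  sasaki-top n = antisym meet-l (meet-greatest refl (trans top-greatest join-r))

  sasaki-test : ∀ m → (sasaki (m ᗮ) top ᗮ) ≈ m
  sasaki-test m = Eq.trans (ᗮ-cong (sasaki-top (m ᗮ))) (ᗮ-involutive m)

record LinMap {ι c ℓ} (N : CompleteOML ι c ℓ) : Set (c ⊔ˡ ℓ) where
  open CompleteOML N
  field
    fun     : Carrier → Carrier
    adj     : Carrier → Carrier
    adjoint : ∀ x y → (fun x ≤ (y ᗮ)) ⇔ (x ≤ (adj y ᗮ))

module LinOps {ι c ℓ} (N : CompleteOML ι c ℓ) where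
  open CompleteOML N
  open IsPartialOrder isPartialOrder using (refl; reflexive; trans)
  open OMLFacts N
  open LinMap

  _≈L_ : LinMap N → LinMap N → Set (c ⊔ˡ ℓ)
  f ≈L g = ∀ x → fun f x ≈ fun g x

  ≈L-isEquivalence : IsEquivalence _≈L_
  ≈L-isEquivalence = record
    { refl  = λ x → IsPartialOrder.Eq.refl isPartialOrder
    ; sym   = λ p x → IsPartialOrder.Eq.sym isPartialOrder (p x)
    ; trans = λ p q x → IsPartialOrder.Eq.trans isPartialOrder (p x) (q x) }

  linJoin : {I : Set ι} → (I → LinMap N) → LinMap N
  linJoin {I} fs = record
    { fun = λ x → ⋁ (λ i → fun (fs i) x)
    ; adj = λ y → ⋁ (λ i → adj (fs i) y)
    ; adjoint = λ x y →
        (λ p → swap (⋁-least _ _ λ i →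
                 swap (proj₁ (adjoint (fs i) x y) (trans (⋁-upper (λ j → fun (fs j) x) i) p)))) ,
        (λ p → ⋁-least _ _ λ i →
                 proj₂ (adjoint (fs i) x y)
                   (swap (trans (⋁-upper (λ j → adj (fs j) y) i) (swap p)))) }

  linComp : LinMap N → LinMap N → LinMap N
  linComp f g = record
    { fun = λ x → fun f (fun g x)
    ; adj = λ y → adj g (adj f y)
    ; adjoint = λ x y →
        (λ p → proj₁ (adjoint g x (adj f y)) (proj₁ (adjoint f (fun g x) y) p)) ,
        (λ p → proj₂ (adjoint f (fun g x) y) (proj₂ (adjoint g x (adj f y)) p)) }

  linStar : LinMap N → LinMap N
  linStar f = record
    { fun = adj f
    ; adj = fun f
    ; adjoint = λ x y →
        (λ p → swap (proj₂ (adjoint f y x) (swap p))) ,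
        (λ p → swap (proj₁ (adjoint f y x) (swap p))) }

  linId : LinMap N
  linId = record { fun = λ x → x ; adj = λ y → y ; adjoint = λ x y → (λ p → p) , (λ p → p) }

  π-map : Carrier → LinMap N
  π-map m = record { fun = sasaki m ; adj = sasaki m ; adjoint = sasaki-adjoint m }

  linTilde : LinMap N → LinMap N
  linTilde f = π-map (fun f top ᗮ)

record PreIDA (ι c ℓ : Level) : Set (lsuc (ι ⊔ˡ c ⊔ˡ ℓ)) where
  infixl 7 _⊙_
  infix  4 _≈_
  infixr 9 ∼_
  infix 10 _*
  field
    Carrier       : Set c
    _≈_           : Rel Carrier ℓ
    isEquivalence : IsEquivalence _≈_
    ⨆             : {I : Set ι} → (I → Carrier) → Carrier
    _⊙_           : Carrier → Carrier → Carrier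
    _*            : Carrier → Carrier
    ∼_            : Carrier → Carrier
    e             : Carrier

  infixl 6 _⊔_
  _⊔_ : Carrier → Carrier → Carrier
  x ⊔ y = ⨆ {Lift ι Bool} (pair x y)

  _≤_ : Carrier → Carrier → Set ℓ
  x ≤ y = (x ⊔ y) ≈ y

  IsTilde : Carrier → Set (c ⊔ˡ ℓ)
  IsTilde w = Σ Carrier (λ k → w ≈ ∼ k)

  Tilde : Set (c ⊔ˡ ℓ)
  Tilde = Σ Carrier IsTilde

  ⋁ : {I : Set ι} → (I → Carrier) → Carrier
  ⋁ W = ∼ ∼ ⨆ W

  _≼_ : Carrier → Carrier → Set ℓ
  k ≼ l = ⋁ {Lift ι Bool} (pair k l) ≈ l

  _•_ : Carrier → Carrier → Carrier
  k • v = ∼ ∼ (k ⊙ v)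

  _≡ᴷ_ : Carrier → Carrier → Set (c ⊔ˡ ℓ)
  k ≡ᴷ l = ∀ w → IsTilde w → (k • w) ≈ (l • w)

  _≈̃_ : Tilde → Tilde → Set ℓ
  v ≈̃ w = proj₁ v ≈ proj₁ w

  _≼̃_ : Tilde → Tilde → Set ℓ
  v ≼̃ w = proj₁ v ≼ proj₁ w

  _ᗮ̃ : Tilde → Tilde
  w ᗮ̃ = (∼ proj₁ w) , (proj₁ w , IsEquivalence.refl isEquivalence)

  bullet : Carrier → Tilde → Tilde
  bullet k w = (k • proj₁ w) , (∼ (k ⊙ proj₁ w) , IsEquivalence.refl isEquivalence)

record IsIDA {ι c ℓ} (K : PreIDA ι c ℓ) : Set (lsuc ι ⊔ˡ c ⊔ˡ ℓ) where
  open PreIDA K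
  field
    ≤-isPartialOrder : IsPartialOrder _≈_ _≤_
    ⨆-upper   : ∀ {I : Set ι} (f : I → Carrier) (i : I) → f i ≤ ⨆ f
    ⨆-least   : ∀ {I : Set ι} (f : I → Carrier) (u : Carrier) → (∀ i → f i ≤ u) → ⨆ f ≤ u
    ⨆-cong    : ∀ {I : Set ι} {f g : I → Carrier} → (∀ i → f i ≈ g i) → ⨆ f ≈ ⨆ g
    ⊙-cong    : ∀ {x x' y y'} → x ≈ x' → y ≈ y' → x ⊙ y ≈ x' ⊙ y'
    *-cong    : ∀ {x y} → x ≈ y → x * ≈ y *
    ∼-cong    : ∀ {x y} → x ≈ y → ∼ x ≈ ∼ y
    ⊙-assoc   : ∀ x y z → (x ⊙ y) ⊙ z ≈ x ⊙ (y ⊙ z)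
    ⊙-distribˡ : ∀ x {I : Set ι} (f : I → Carrier) → x ⊙ ⨆ f ≈ ⨆ (λ i → x ⊙ f i)
    ⊙-distribʳ : ∀ x {I : Set ι} (f : I → Carrier) → ⨆ f ⊙ x ≈ ⨆ (λ i → f i ⊙ x)
    ⊙-identityˡ : ∀ x → e ⊙ x ≈ x
    ⊙-identityʳ : ∀ x → x ⊙ e ≈ x
    *-involutive : ∀ x → (x *) * ≈ x
    *-antihom    : ∀ x y → (x ⊙ y) * ≈ (y *) ⊙ (x *)
    *-⨆          : ∀ {I : Set ι} (f : I → Carrier) → (⨆ f) * ≈ ⨆ (λ i → f i *)
    ida1 : ∀ x y → ∼ (x ⊙ ∼ ∼ y) ≈ ∼ (x ⊙ y)
    ida2 : ∀ {I : Set ι} (f : I → Carrier) → ∼ (⨆ (λ i → ∼ ∼ f i)) ≈ ∼ (⨆ f)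
    ida3 : ∀ x → (∼ x) * ≈ ∼ x
    ida4 : ∀ x y → ∼ ∼ (∼ ∼ x ⊙ y) ≈ ∼ (∼ x ⊔ ∼ (∼ x ⊔ y))

SemiFoulis : ∀ {ι c ℓ} → PreIDA ι c ℓ → Set (lsuc ι ⊔ˡ c ⊔ˡ ℓ)
SemiFoulis {ι} K = IsCompleteOML ι _≈̃_ _≼̃_ _ᗮ̃
  where open PreIDA K

TildeOML : ∀ {ι c ℓ} (K : PreIDA ι c ℓ) → SemiFoulis K → CompleteOML ι (c ⊔ˡ ℓ) ℓ
TildeOML K sf = record
  { Carrier = Tilde ; _≈_ = _≈̃_ ; _≤_ = _≼̃_ ; _ᗮ = _ᗮ̃ ; isCompleteOML = sf }
  where open PreIDA K

record IDAMorphism {ι c ℓ c' ℓ'} (K : PreIDA ι c ℓ) (K' : PreIDA ι c' ℓ')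
                   : Set (lsuc ι ⊔ˡ c ⊔ˡ ℓ ⊔ˡ c' ⊔ˡ ℓ') where
  private
    module K  = PreIDA K
    module K' = PreIDA K'
  field
    map      : K.Carrier → K'.Carrier
    map-cong : ∀ {x y} → x K.≈ y → map x K'.≈ map y
    map-⨆    : ∀ {I : Set ι} (f : I → K.Carrier) → map (K.⨆ f) K'.≈ K'.⨆ (λ i → map (f i))
    map-⊙    : ∀ x y → map (x K.⊙ y) K'.≈ (map x K'.⊙ map y)
    map-e    : map K.e K'.≈ K'.e
    map-*    : ∀ x → map (x K.*) K'.≈ (map x K'.*)
    map-∼    : ∀ x → map (K.∼ x) K'.≈ (K'.∼ map x)

LinPre : ∀ {ι c ℓ} → CompleteOML ι c ℓ → PreIDA ι (c ⊔ˡ ℓ) (c ⊔ˡ ℓ)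
LinPre N = record
  { Carrier = LinMap N
  ; _≈_ = _≈L_
  ; isEquivalence = ≈L-isEquivalence
  ; ⨆ = linJoin
  ; _⊙_ = linComp
  ; _* = linStar
  ; ∼_ = linTilde
  ; e = linId }
  where open LinOps N

record InvSubmonoid {ι} (N : CompleteOML ι ι ι) : Set (lsuc ι) where
  open CompleteOML N using (Carrier)
  open LinOps N
  field
    inL      : LinMap N → Set ι
    inL-resp : ∀ {f g} → f ≈L g → inL f → inL g
    inL-id   : inL linId
    inL-comp : ∀ {f g} → inL f → inL g → inL (linComp f g)
    inL-star : ∀ {f} → inL f → inL (linStar f)
    inL-π    : ∀ m → inL (π-map m)

module PowerOps {ι} (N : CompleteOML ι ι ι) (L : InvSubmonoid N) where
  open CompleteOML N using (Carrier; ⋁; top; _ᗮ)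
  open LinOps N
  open InvSubmonoid L
  open LinMap
  private
    module E = IsEquivalence ≈L-isEquivalence

  -- subsets of L (as ≈-closed predicates on Lin(M) contained in L)
  record PSub : Set (lsuc ι) where
    field
      mem      : LinMap N → Set ι
      mem-resp : ∀ {f g} → f ≈L g → mem f → mem g
      mem-L    : ∀ {f} → mem f → inL f
  open PSub

  _≈P_ : PSub → PSub → Set ι
  A ≈P B = (∀ f → mem A f → mem B f) × (∀ f → mem B f → mem A f)

  ≈P-isEquivalence : IsEquivalence _≈P_
  ≈P-isEquivalence = record
    { refl  = (λ f p → p) , (λ f p → p)
    ; sym   = λ { (p , q) → q , p }
    ; trans = λ { (p , q) (p' , q') → (λ f x → p' f (p f x)) , (λ f x → q f (q' f x)) } }

  singleton : (f : LinMap N) → inL f → PSub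
  singleton f lf = record
    { mem = λ h → h ≈L f
    ; mem-resp = λ {g} {h} e p → E.trans {h} {g} {f} (E.sym {g} {h} e) p
    ; mem-L = λ {g} p → inL-resp {f} {g} (E.sym {g} {f} p) lf }

  P⨆ : {I : Set ι} → (I → PSub) → PSub
  P⨆ {I} F = record
    { mem = λ f → Σ I (λ i → mem (F i) f)
    ; mem-resp = λ { e (i , p) → i , mem-resp (F i) e p }
    ; mem-L = λ { (i , p) → mem-L (F i) p } }

  _P⊙_ : PSub → PSub → PSub
  A P⊙ B = record
    { mem = λ h → Σ (LinMap N) λ a → Σ (LinMap N) λ b → mem A a × mem B b × (h ≈L linComp a b)
    ; mem-resp = λ { {g} {h} e (a , b , pa , pb , q) →
                     a , b , pa , pb , E.trans {h} {g} {linComp a b} (E.sym {g} {h} e) q }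
    ; mem-L = λ { {h} (a , b , pa , pb , q) →
                  inL-resp {linComp a b} {h} (E.sym {h} {linComp a b} q)
                    (inL-comp (mem-L A pa) (mem-L B pb)) } }

  P* : PSub → PSub
  P* A = record
    { mem = λ h → Σ (LinMap N) λ a → mem A a × (h ≈L linStar a)
    ; mem-resp = λ { {g} {h} e (a , pa , q) →
                     a , pa , E.trans {h} {g} {linStar a} (E.sym {g} {h} e) q }
    ; mem-L = λ { {h} (a , pa , q) →
                  inL-resp {linStar a} {h} (E.sym {h} {linStar a} q) (inL-star (mem-L A pa)) } }

  P∼ : PSub → PSub
  P∼ A = singleton (π-map ((⋁ {Σ (LinMap N) (mem A)} (λ p → fun (proj₁ p) top)) ᗮ)) (inL-π _)

  Pe : PSub
  Pe = singleton linId inL-id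

PPre : ∀ {ι} (N : CompleteOML ι ι ι) → InvSubmonoid N → PreIDA ι (lsuc ι) ι
PPre N L = record
  { Carrier = PSub
  ; _≈_ = _≈P_
  ; isEquivalence = ≈P-isEquivalence
  ; ⨆ = P⨆
  ; _⊙_ = _P⊙_
  ; _* = P*
  ; ∼_ = P∼
  ; e = Pe }
  where open PowerOps N L

-- The involutive submonoid 𝒯(Lin(M)) of Lin(M), built from (T1).

mkL : ∀ {ι} (N : CompleteOML ι ι ι)
      (TL : LinMap N → Set ι)
      (TL-resp : ∀ {f g} → LinOps._≈L_ N f g → TL f → TL g)
      (TL-tilde : ∀ f → TL (LinOps.linTilde N f))
      (TL-e : TL (LinOps.linId N))
      (TL-⊙ : ∀ {f g} → TL f → TL g → TL (LinOps.linComp N f g))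
      (TL-* : ∀ {f} → TL f → TL (LinOps.linStar N f))
      → InvSubmonoid N
mkL N TL TL-resp TL-tilde TL-e TL-⊙ TL-* = record
  { inL = TL
  ; inL-resp = TL-resp
  ; inL-id = TL-e
  ; inL-comp = TL-⊙
  ; inL-star = TL-*
  ; inL-π = λ m → TL-resp (λ x → OMLFacts.sasaki-cong N x (OMLFacts.sasaki-test N m))
                          (TL-tilde (LinOps.π-map N (CompleteOML._ᗮ N m))) }

record NuIso {ι c ℓ} (K : PreIDA ι c ℓ) (sf : SemiFoulis K)
             (TK : PreIDA.Carrier K → Set (c ⊔ˡ ℓ))
             (TK-⊙ : ∀ {x y} → TK x → TK y → TK (PreIDA._⊙_ K x y))
             (TK-e : TK (PreIDA.e K))
             (TK-* : ∀ {x} → TK x → TK (PreIDA._* K x))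
             (TL : LinMap (TildeOML K sf) → Set (c ⊔ˡ ℓ))
             : Set (lsuc ι ⊔ˡ c ⊔ˡ ℓ) where
  open PreIDA K
  open LinOps (TildeOML K sf)
  field
    ν      : (k : Carrier) → TK k → LinMap (TildeOML K sf)
    ν-fun  : ∀ k (tk : TK k) (w : Tilde) → LinMap.fun (ν k tk) w ≈̃ bullet k w
    ν-T    : ∀ k (tk : TK k) → TL (ν k tk)
    ν-⊙    : ∀ k l (tk : TK k) (tl : TK l) →
             ν (k ⊙ l) (TK-⊙ tk tl) ≈L linComp (ν k tk) (ν l tl)
    ν-e    : ν e TK-e ≈L linId
    ν-*    : ∀ k (tk : TK k) → ν (k *) (TK-* tk) ≈L linStar (ν k tk)
    ν-inj  : ∀ k l (tk : TK k) (tl : TK l) → ν k tk ≈L ν l tl → k ≈ l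
    ν-surj : ∀ φ → TL φ → Σ Carrier λ k → Σ (TK k) λ tk → ν k tk ≈L φ

record SingIso {ι} (N : CompleteOML ι ι ι) (L : InvSubmonoid N)
               (TP : PreIDA.Carrier (PPre N L) → Set (lsuc ι)) : Set (lsuc ι) where
  open InvSubmonoid L
  open LinOps N
  open PowerOps N L
  field
    sing-T    : ∀ f (lf : inL f) → TP (singleton f lf)
    sing-⊙    : ∀ f g (lf : inL f) (lg : inL g) →
                singleton (linComp f g) (inL-comp lf lg) ≈P (singleton f lf P⊙ singleton g lg)
    sing-e    : singleton linId inL-id ≈P Pe
    sing-*    : ∀ f (lf : inL f) → singleton (linStar f) (inL-star lf) ≈P P* (singleton f lf)
    sing-inj  : ∀ f g (lf : inL f) (lg : inL g) → singleton f lf ≈P singleton g lg → f ≈L g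
    sing-surj : ∀ A → TP A → Σ (LinMap N) λ f → Σ (inL f) λ lf → A ≈P singleton f lf

-- The functor 𝒯 from IDAs to involutive monoids, with (T1)–(T4).
-- 𝒯(K) is represented as a (≈-closed) subset of K; by (T4) the action
-- on morphisms is restriction, so functoriality amounts to IDA morphisms
-- mapping 𝒯(K) into 𝒯(K').

record TFunctor (ι : Level) : Setω where
  open PreIDA
  field
    T        : ∀ {c ℓ} (K : PreIDA ι c ℓ) → Carrier K → Set (c ⊔ˡ ℓ)
    T-resp   : ∀ {c ℓ} (K : PreIDA ι c ℓ) {x y} → _≈_ K x y → T K x → T K y
    T-tilde  : ∀ {c ℓ} (K : PreIDA ι c ℓ) x → T K (∼_ K x)
    T-e      : ∀ {c ℓ} (K : PreIDA ι c ℓ) → T K (e K)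
    T-⊙      : ∀ {c ℓ} (K : PreIDA ι c ℓ) {x y} → T K x → T K y → T K (_⊙_ K x y)
    T-*      : ∀ {c ℓ} (K : PreIDA ι c ℓ) {x} → T K x → T K (_* K x)
    T-mor    : ∀ {c ℓ c' ℓ'} (K : PreIDA ι c ℓ) (K' : PreIDA ι c' ℓ') →
               IsIDA K → IsIDA K' → (h : IDAMorphism K K') →
               ∀ x → T K x → T K' (IDAMorphism.map h x)
    T2       : ∀ {c ℓ} (K : PreIDA ι c ℓ) → IsIDA K → (sf : SemiFoulis K) →
               (∀ s t → T K s → T K t → (_≈_ K s t ⇔ _≡ᴷ_ K s t)) →
               NuIso K sf (T K) (T-⊙ K) (T-e K) (T-* K) (T (LinPre (TildeOML K sf)))
    T3       : (N : CompleteOML ι ι ι) →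
               SingIso N
                 (mkL N (T (LinPre N)) (T-resp (LinPre N)) (T-tilde (LinPre N))
                        (T-e (LinPre N)) (T-⊙ (LinPre N)) (T-* (LinPre N)))
                 (T (PPre N (mkL N (T (LinPre N)) (T-resp (LinPre N)) (T-tilde (LinPre N))
                                   (T-e (LinPre N)) (T-⊙ (LinPre N)) (T-* (LinPre N)))))

L𝒯 : ∀ {ι} → TFunctor ι → (N : CompleteOML ι ι ι) → InvSubmonoid N
L𝒯 𝒯 N = mkL N (T (LinPre N)) (T-resp (LinPre N)) (T-tilde (LinPre N))
               (T-e (LinPre N)) (T-⊙ (LinPre N)) (T-* (LinPre N))
  where open TFunctor 𝒯

SameSubset : ∀ {ι c ℓ} (K : PreIDA ι c ℓ) {I J : Set ι} →
             (I → PreIDA.Carrier K) → (J → PreIDA.Carrier K) → Set (ι ⊔ˡ ℓ)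
SameSubset K {I} {J} S S' =
  (∀ i → Σ J λ j → PreIDA._≈_ K (S i) (S' j)) × (∀ j → Σ I λ i → PreIDA._≈_ K (S' j) (S i))

record IsTODA {ι c ℓ} (𝒯 : TFunctor ι) (K : PreIDA ι c ℓ) : Setω where
  open PreIDA K
  open TFunctor 𝒯 using (T)
  field
    isIDA : IsIDA K
    toda1 : SemiFoulis K
    toda2 : ∀ {a} (A : Carrier → Set a) →
            (∀ {x y} → x ≈ y → A x → A y) →
            (∀ x → T K x → A x) →
            (∀ x y → A x → A y → A (x ⊙ y)) →
            (∀ x → A x → A (x *)) →
            (∀ {I : Set ι} (f : I → Carrier) → (∀ i → A (f i)) → A (⨆ f)) →
            ∀ x → A x
    toda3 : ∀ {I J : Set ι} (S : I → Carrier) (S' : J → Carrier) →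
            (∀ i → T K (S i)) → (∀ j → T K (S' j)) →
            (⨆ S ≈ ⨆ S') ⇔ SameSubset K S S'
    toda4 : ∀ s t → T K s → T K t → (s ≈ t) ⇔ (s ≡ᴷ t)

-- Every subset A ⊆ L acts on M by act A z = ⋁_{a ∈ A} a z, and this action turns
-- ⊙ into composition and unions into joins; since ∼ A is the Sasaki projection onto
-- (act A 1)ᗮ, each axiom on ∼ becomes an identity between elements of M, the
-- orthomodular one (ida4) being the formula π_m(v)ᗮ = mᗮ ∨ (mᗮ ∨ v)ᗮ.  The same
-- value A ↦ act A 1 is an order-isomorphism from the tests {π_m} onto M, which makes
-- P(L) semi-Foulis.  By (T3) the elements of 𝒯(P(L)) are exactly the singletons {f},
-- f ∈ L: every subset is the union of its singletons (TODA2), unions of singletons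
-- determine their members (TODA3), and act ({f} • {π_z}) 1 = f z, so ≡ separates
-- singletons (TODA4).
module Submission where

open import Level using (Level; lift)
open import Data.Bool.Base using (true; false)
open import Data.Product using (Σ; _,_; proj₁; proj₂)
open import Relation.Binary.Bundles using (Setoid)
open import Relation.Binary.Core using (Rel)
import Relation.Binary.Reasoning.Setoid
open import Relation.Binary.Structures using (IsPartialOrder)
open import Defs

module CompleteOMLProperties {ι c ℓ} (N : CompleteOML ι c ℓ) where
  open CompleteOML N
  open IsPartialOrder isPartialOrder public using (refl; reflexive; trans; antisym; module Eq)
  open OMLFacts N public

  setoid : Setoid c ℓ
  setoid = record { isEquivalence = IsPartialOrder.isEquivalence isPartialOrder }

  x≤xᗮᗮ : ∀ {x} → x ≤ ((x ᗮ) ᗮ)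
  x≤xᗮᗮ {x} = reflexive (Eq.sym (ᗮ-involutive x))

  ⋁-mono : ∀ {I J : Set ι} (f : I → Carrier) (g : J → Carrier) →
           (∀ i → Σ J λ j → f i ≤ g j) → ⋁ f ≤ ⋁ g
  ⋁-mono f g h = ⋁-least f (⋁ g) λ i → trans (proj₂ (h i)) (⋁-upper g (proj₁ (h i)))

  ⋁-cong : ∀ {I : Set ι} {f g : I → Carrier} → (∀ i → f i ≈ g i) → ⋁ f ≈ ⋁ g
  ⋁-cong {f = f} {g} h =
    antisym (⋁-mono f g λ i → i , reflexive (h i)) (⋁-mono g f λ i → i , reflexive (Eq.sym (h i)))

  join-cong : ∀ {a a' b b'} → a ≈ a' → b ≈ b' → join a b ≈ join a' b'
  join-cong p q = ⋁-cong λ { (lift true) → p ; (lift false) → q }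

  meet-cong : ∀ {a a' b b'} → a ≈ a' → b ≈ b' → meet a b ≈ meet a' b'
  meet-cong p q = ᗮ-cong (join-cong (ᗮ-cong p) (ᗮ-cong q))

  sasaki-ᗮ : ∀ m v → (sasaki m v ᗮ) ≈ join (m ᗮ) (join (m ᗮ) v ᗮ)
  sasaki-ᗮ m v = ᗮ-involutive _

module LinMapProperties {ι c ℓ} (N : CompleteOML ι c ℓ) where
  open CompleteOML N
  open CompleteOMLProperties N
  open LinMap

  fun-mono : (f : LinMap N) → ∀ {x y} → x ≤ y → fun f x ≤ fun f y
  fun-mono f {x} {y} p =
    trans (proj₂ (adjoint f x (fun f y ᗮ)) (trans p (proj₁ (adjoint f y (fun f y ᗮ)) x≤xᗮᗮ)))
          (reflexive (ᗮ-involutive _))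

  fun-cong : (f : LinMap N) → ∀ {x y} → x ≈ y → fun f x ≈ fun f y
  fun-cong f p = antisym (fun-mono f (reflexive p)) (fun-mono f (reflexive (Eq.sym p)))

  fun-⋁ : (f : LinMap N) {I : Set ι} (g : I → Carrier) → fun f (⋁ g) ≈ ⋁ (λ i → fun f (g i))
  fun-⋁ f g = antisym fun-⋁≤ (⋁-least _ _ λ i → fun-mono f (⋁-upper g i))
    where
      u = ⋁ (λ i → fun f (g i))
      fun-⋁≤ : fun f (⋁ g) ≤ u
      fun-⋁≤ = trans (proj₂ (adjoint f (⋁ g) (u ᗮ))
                       (⋁-least g _ λ i → proj₁ (adjoint f (g i) (u ᗮ)) (trans (⋁-upper _ i) x≤xᗮᗮ)))
                     (reflexive (ᗮ-involutive u))

  adj-unique : (a b : LinMap N) → (∀ x → fun a x ≈ fun b x) → ∀ y → adj a y ≈ adj b y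
  adj-unique a b h y =
    Eq.trans (Eq.sym (ᗮ-involutive _))
      (Eq.trans (ᗮ-cong (antisym (adjᗮ-≤ a b h) (adjᗮ-≤ b a (λ x → Eq.sym (h x)))))
                (ᗮ-involutive _))
    where
      adjᗮ-≤ : (a b : LinMap N) → (∀ x → fun a x ≈ fun b x) → (adj a y ᗮ) ≤ (adj b y ᗮ)
      adjᗮ-≤ a b h = proj₁ (adjoint b _ y) (trans (reflexive (Eq.sym (h _))) (proj₂ (adjoint a _ y) refl))

module InducedCompleteOML {ι c ℓ} (N : CompleteOML ι c ℓ)
  {c' ℓ'} {A : Set c'} (_≈'_ _≤'_ : Rel A ℓ') (_ᗮ' : A → A)
  (⋁' : {I : Set ι} → (I → A) → A) (Φ : A → CompleteOML.Carrier N)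
  (≈⇔ : ∀ {x y} → (x ≈' y) ⇔ CompleteOML._≈_ N (Φ x) (Φ y))
  (≤⇔ : ∀ {x y} → (x ≤' y) ⇔ CompleteOML._≤_ N (Φ x) (Φ y))
  (Φ-ᗮ : ∀ x → CompleteOML._≈_ N (Φ (x ᗮ')) (CompleteOML._ᗮ N (Φ x)))
  (Φ-⋁ : ∀ {I : Set ι} (F : I → A) → CompleteOML._≈_ N (Φ (⋁' F)) (CompleteOML.⋁ N (λ i → Φ (F i))))
  where
  open CompleteOML N hiding (isCompleteOML)
  open CompleteOMLProperties N
  private
    module O = LatticeOps ⋁' _ᗮ'

  Φ-join : ∀ x y → Φ (O.join x y) ≈ join (Φ x) (Φ y)
  Φ-join x y = Eq.trans (Φ-⋁ _) (⋁-cong λ { (lift true) → Eq.refl ; (lift false) → Eq.refl })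

  Φ-meet : ∀ x y → Φ (O.meet x y) ≈ meet (Φ x) (Φ y)
  Φ-meet x y = Eq.trans (Φ-ᗮ _) (ᗮ-cong (Eq.trans (Φ-join _ _) (join-cong (Φ-ᗮ x) (Φ-ᗮ y))))

  Φ-top : Φ O.top ≈ top
  Φ-top = Eq.trans (Φ-ᗮ _) (ᗮ-cong (Eq.trans (Φ-⋁ _) (⋁-cong λ { (lift ()) })))

  ≤'-isPartialOrder : IsPartialOrder _≈'_ _≤'_
  ≤'-isPartialOrder = record
    { isPreorder = record
      { isEquivalence = record
        { refl = proj₂ ≈⇔ Eq.refl
        ; sym = λ p → proj₂ ≈⇔ (Eq.sym (proj₁ ≈⇔ p))
        ; trans = λ p q → proj₂ ≈⇔ (Eq.trans (proj₁ ≈⇔ p) (proj₁ ≈⇔ q)) }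
      ; reflexive = λ p → proj₂ ≤⇔ (reflexive (proj₁ ≈⇔ p))
      ; trans = λ p q → proj₂ ≤⇔ (trans (proj₁ ≤⇔ p) (proj₁ ≤⇔ q)) }
    ; antisym = λ p q → proj₂ ≈⇔ (antisym (proj₁ ≤⇔ p) (proj₁ ≤⇔ q)) }

  isCompleteOML : IsCompleteOML ι _≈'_ _≤'_ _ᗮ'
  isCompleteOML = record
    { isPartialOrder = ≤'-isPartialOrder
    ; ᗮ-cong = λ p → proj₂ ≈⇔ (Eq.trans (Φ-ᗮ _) (Eq.trans (ᗮ-cong (proj₁ ≈⇔ p)) (Eq.sym (Φ-ᗮ _))))
    ; ᗮ-involutive = λ x → proj₂ ≈⇔ (Eq.trans (Φ-ᗮ _) (Eq.trans (ᗮ-cong (Φ-ᗮ x)) (ᗮ-involutive _)))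
    ; ᗮ-antitone = λ p → proj₂ ≤⇔ (trans (reflexive (Φ-ᗮ _))
                            (trans (ᗮ-antitone (proj₁ ≤⇔ p)) (reflexive (Eq.sym (Φ-ᗮ _)))))
    ; ⋁ = ⋁'
    ; ⋁-upper = λ F i → proj₂ ≤⇔ (trans (⋁-upper (λ j → Φ (F j)) i) (reflexive (Eq.sym (Φ-⋁ F))))
    ; ⋁-least = λ F u h → proj₂ ≤⇔ (trans (reflexive (Φ-⋁ F)) (⋁-least _ _ λ i → proj₁ ≤⇔ (h i)))
    ; ᗮ-complement = λ x → proj₂ ≈⇔
        (Eq.trans (Φ-join _ _) (Eq.trans (join-cong Eq.refl (Φ-ᗮ x))
          (Eq.trans (ᗮ-complement (Φ x)) (Eq.sym Φ-top))))
    ; orthomodular = λ {x} {y} p → proj₂ ≈⇔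
        (Eq.trans (orthomodular (proj₁ ≤⇔ p))
          (Eq.sym (Eq.trans (Φ-join _ _)
            (join-cong Eq.refl (Eq.trans (Φ-meet _ _) (meet-cong (Φ-ᗮ x) Eq.refl))))))
    }

module PowerSetProperties {ι} (N : CompleteOML ι ι ι) (L : InvSubmonoid N) where
  open CompleteOML N
  open CompleteOMLProperties N
  open LinMapProperties N
  open LinOps N
  open InvSubmonoid L
  open PowerOps N L
  open PSub
  open LinMap

  P-setoid : Setoid (Level.suc ι) ι
  P-setoid = record { isEquivalence = ≈P-isEquivalence }

  module ≈P-Reasoning = Relation.Binary.Reasoning.Setoid P-setoid

  _⊆_ : PSub → PSub → Set ι
  A ⊆ B = ∀ f → mem A f → mem B f

  act : PSub → Carrier → Carrier
  act A z = ⋁ {Σ (LinMap N) (mem A)} (λ a → fun (proj₁ a) z)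

  act⊤ : PSub → Carrier
  act⊤ A = act A top

  Sπ : Carrier → PSub
  Sπ m = singleton (π-map m) (inL-π m)

  singleton-cong : ∀ {f g} lf lg → f ≈L g → singleton f lf ≈P singleton g lg
  singleton-cong lf lg f≈g = (λ h p x → Eq.trans (p x) (f≈g x)) , (λ h p x → Eq.trans (p x) (Eq.sym (f≈g x)))

  Sπ-cong : ∀ {m m'} → m ≈ m' → Sπ m ≈P Sπ m'
  Sπ-cong m≈m' = singleton-cong (inL-π _) (inL-π _) (λ x → sasaki-cong x m≈m')

  act-mono : ∀ A B → A ⊆ B → ∀ z → act A z ≤ act B z
  act-mono A B A⊆B z = ⋁-mono _ _ λ { (f , p) → (f , A⊆B f p) , refl }

  act-cong : ∀ A B → A ≈P B → ∀ z → act A z ≈ act B z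
  act-cong A B (A⊆B , B⊆A) z = antisym (act-mono A B A⊆B z) (act-mono B A B⊆A z)

  act-singleton : ∀ f lf z → act (singleton f lf) z ≈ fun f z
  act-singleton f lf z = antisym (⋁-least _ _ λ { (h , h≈f) → reflexive (h≈f z) })
                                 (⋁-upper (λ p → fun (proj₁ p) z) (f , λ x → Eq.refl))

  act-congʳ : ∀ A {z z'} → z ≈ z' → act A z ≈ act A z'
  act-congʳ A z≈z' = ⋁-cong (λ a → fun-cong (proj₁ a) z≈z')

  act-≈singleton : ∀ A f lf → A ≈P singleton f lf → ∀ z → act A z ≈ fun f z
  act-≈singleton A f lf A≈f z = Eq.trans (act-cong A (singleton f lf) A≈f z) (act-singleton f lf z)

  act-⊙ : ∀ A B z → act (A P⊙ B) z ≈ act A (act B z)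
  act-⊙ A B z = antisym
    (⋁-least _ _ λ { (h , a , b , pa , pb , h≈ab) →
        trans (reflexive (h≈ab z))
          (trans (fun-mono a (⋁-upper (λ p → fun (proj₁ p) z) (b , pb)))
                 (⋁-upper (λ p → fun (proj₁ p) (act B z)) (a , pa))) })
    (⋁-least _ _ λ { (a , pa) →
        trans (reflexive (fun-⋁ a (λ p → fun (proj₁ p) z)))
          (⋁-mono _ _ λ { (b , pb) → (linComp a b , a , b , pa , pb , (λ x → Eq.refl)) , refl }) })

  act-⨆ : ∀ {I : Set ι} (F : I → PSub) z → act (P⨆ F) z ≈ ⋁ (λ i → act (F i) z)
  act-⨆ F z = antisym
    (⋁-least _ _ λ { (h , i , p) →
        trans (⋁-upper (λ q → fun (proj₁ q) z) (h , p)) (⋁-upper (λ j → act (F j) z) i) })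
    (⋁-least _ _ λ i → ⋁-mono _ _ λ { (h , p) → (h , i , p) , refl })

  act-⊔ : ∀ A B z → act (P⨆ (pair A B)) z ≈ join (act A z) (act B z)
  act-⊔ A B z = Eq.trans (act-⨆ (pair A B) z) (⋁-cong λ { (lift true) → Eq.refl ; (lift false) → Eq.refl })

  act⊤-Sπ : ∀ m → act⊤ (Sπ m) ≈ m
  act⊤-Sπ m = Eq.trans (act-singleton _ (inL-π m) top) (sasaki-top m)

  act⊤-∼ : ∀ A → act⊤ (P∼ A) ≈ (act⊤ A ᗮ)
  act⊤-∼ A = act⊤-Sπ _

  act⊤-∼∼ : ∀ A → act⊤ (P∼ (P∼ A)) ≈ act⊤ A
  act⊤-∼∼ A = Eq.trans (act⊤-∼ (P∼ A)) (Eq.trans (ᗮ-cong (act⊤-∼ A)) (ᗮ-involutive _))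

  P∼-cong : ∀ A B → act⊤ A ≈ act⊤ B → P∼ A ≈P P∼ B
  P∼-cong A B eq = Sπ-cong (ᗮ-cong eq)

  ∼≈Sπ : ∀ A → P∼ A ≈P Sπ (act⊤ (P∼ A))
  ∼≈Sπ A = Sπ-cong (Eq.sym (act⊤-∼ A))

  ∼∼≈Sπ : ∀ A → P∼ (P∼ A) ≈P Sπ (act⊤ A)
  ∼∼≈Sπ A = begin
    P∼ (P∼ A)                ≈⟨ ∼≈Sπ (P∼ A) ⟩
    Sπ (act⊤ (P∼ (P∼ A)))    ≈⟨ Sπ-cong (act⊤-∼∼ A) ⟩
    Sπ (act⊤ A)              ∎
    where open ≈P-Reasoning

  ⊆⇒≤ : ∀ {A B} → A ⊆ B → P⨆ (pair A B) ≈P B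
  ⊆⇒≤ A⊆B = (λ { f (lift true , p) → A⊆B f p ; f (lift false , p) → p }) , (λ f p → lift false , p)

  ≤⇒⊆ : ∀ {A B} → P⨆ (pair A B) ≈P B → A ⊆ B
  ≤⇒⊆ A⊔B≈B f p = proj₁ A⊔B≈B f (lift true , p)

  P⊙-assoc : ∀ A B C → ((A P⊙ B) P⊙ C) ≈P (A P⊙ (B P⊙ C))
  P⊙-assoc A B C =
    (λ { h (ab , c , (a , b , pa , pb , ab≈) , pc , h≈) →
           a , linComp b c , pa , (b , c , pb , pc , λ w → Eq.refl) ,
           (λ w → Eq.trans (h≈ w) (ab≈ (fun c w))) }) ,
    (λ { h (a , bc , pa , (b , c , pb , pc , bc≈) , h≈) →
           linComp a b , c , (a , b , pa , pb , λ w → Eq.refl) , pc ,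
           (λ w → Eq.trans (h≈ w) (fun-cong a (bc≈ w))) })

  P⊙-identityˡ : ∀ A → (Pe P⊙ A) ≈P A
  P⊙-identityˡ A =
    (λ { h (a , b , a≈id , pb , h≈) → mem-resp A (λ w → Eq.sym (Eq.trans (h≈ w) (a≈id (fun b w)))) pb }) ,
    (λ h p → linId , h , (λ w → Eq.refl) , p , (λ w → Eq.refl))

  P⊙-identityʳ : ∀ A → (A P⊙ Pe) ≈P A
  P⊙-identityʳ A =
    (λ { h (a , b , pa , b≈id , h≈) → mem-resp A (λ w → Eq.sym (Eq.trans (h≈ w) (fun-cong a (b≈id w)))) pa }) ,
    (λ h p → h , linId , p , (λ w → Eq.refl) , (λ w → Eq.refl))

  P*-involutive : ∀ A → P* (P* A) ≈P A
  P*-involutive A =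
    (λ { h (a' , (a , pa , a'≈) , h≈) →
           mem-resp A (λ w → Eq.sym (Eq.trans (h≈ w) (adj-unique a' (linStar a) a'≈ w))) pa }) ,
    (λ h p → linStar h , (h , p , λ w → Eq.refl) , (λ w → Eq.refl))

  P*-antihom : ∀ A B → P* (A P⊙ B) ≈P (P* B P⊙ P* A)
  P*-antihom A B =
    (λ { h (c , (a , b , pa , pb , c≈) , h≈) →
           linStar b , linStar a , (b , pb , λ w → Eq.refl) , (a , pa , λ w → Eq.refl) ,
           (λ w → Eq.trans (h≈ w) (adj-unique c (linComp a b) c≈ w)) }) ,
    (λ { h (b' , a' , (b , pb , b'≈) , (a , pa , a'≈) , h≈) →
           linComp a b , (a , b , pa , pb , λ w → Eq.refl) ,
           (λ w → Eq.trans (h≈ w) (Eq.trans (b'≈ (fun a' w)) (fun-cong (linStar b) (a'≈ w)))) })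

  P∼-⊙-∼∼ : ∀ A B → P∼ (A P⊙ P∼ (P∼ B)) ≈P P∼ (A P⊙ B)
  P∼-⊙-∼∼ A B = P∼-cong (A P⊙ P∼ (P∼ B)) (A P⊙ B) (begin
    act⊤ (A P⊙ P∼ (P∼ B))    ≈⟨ act-⊙ A (P∼ (P∼ B)) top ⟩
    act A (act⊤ (P∼ (P∼ B))) ≈⟨ act-congʳ A (act⊤-∼∼ B) ⟩
    act A (act⊤ B)           ≈⟨ act-⊙ A B top ⟨
    act⊤ (A P⊙ B)            ∎)
    where open Relation.Binary.Reasoning.Setoid setoid

  P∼-⨆-∼∼ : ∀ {I : Set ι} (F : I → PSub) → P∼ (P⨆ (λ i → P∼ (P∼ (F i)))) ≈P P∼ (P⨆ F)
  P∼-⨆-∼∼ F = P∼-cong (P⨆ (λ i → P∼ (P∼ (F i)))) (P⨆ F) (begin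
    act⊤ (P⨆ (λ i → P∼ (P∼ (F i)))) ≈⟨ act-⨆ (λ i → P∼ (P∼ (F i))) top ⟩
    ⋁ (λ i → act⊤ (P∼ (P∼ (F i))))  ≈⟨ ⋁-cong (λ i → act⊤-∼∼ (F i)) ⟩
    ⋁ (λ i → act⊤ (F i))            ≈⟨ act-⨆ F top ⟨
    act⊤ (P⨆ F)                     ∎)
    where open Relation.Binary.Reasoning.Setoid setoid

  P∼-selfadjoint : ∀ A → P* (P∼ A) ≈P P∼ A
  P∼-selfadjoint A =
    (λ { h (a , a≈π , h≈) → λ w → Eq.trans (h≈ w) (adj-unique a (π-map (act⊤ A ᗮ)) a≈π w) }) ,
    (λ h h≈π → h , h≈π , (λ w → Eq.trans (h≈π w) (Eq.sym (adj-unique h (π-map (act⊤ A ᗮ)) h≈π w))))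

  act⊤-∼∼⊙ : ∀ A B → act⊤ (P∼ (P∼ A) P⊙ B) ≈ sasaki (act⊤ A) (act⊤ B)
  act⊤-∼∼⊙ A B = begin
    act⊤ (P∼ (P∼ A) P⊙ B)              ≈⟨ act-⊙ (P∼ (P∼ A)) B top ⟩
    act (P∼ (P∼ A)) (act⊤ B)           ≈⟨ act-singleton _ (inL-π _) (act⊤ B) ⟩
    sasaki (act⊤ (P∼ A) ᗮ) (act⊤ B)    ≈⟨ sasaki-cong (act⊤ B) (Eq.trans (ᗮ-cong (act⊤-∼ A)) (ᗮ-involutive _)) ⟩
    sasaki (act⊤ A) (act⊤ B)           ∎
    where open Relation.Binary.Reasoning.Setoid setoid

  P∼-orthomodular : ∀ A B → P∼ (P∼ (P∼ (P∼ A) P⊙ B)) ≈P P∼ (P⨆ (pair (P∼ A) (P∼ (P⨆ (pair (P∼ A) B)))))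
  P∼-orthomodular A B = P∼-cong (P∼ (P∼ (P∼ A) P⊙ B)) (P⨆ (pair (P∼ A) (P∼ (P⨆ (pair (P∼ A) B))))) (begin
    act⊤ (P∼ (P∼ (P∼ A) P⊙ B))                    ≈⟨ act⊤-∼ (P∼ (P∼ A) P⊙ B) ⟩
    (act⊤ (P∼ (P∼ A) P⊙ B) ᗮ)                     ≈⟨ ᗮ-cong (act⊤-∼∼⊙ A B) ⟩
    (sasaki (act⊤ A) (act⊤ B) ᗮ)                  ≈⟨ sasaki-ᗮ (act⊤ A) (act⊤ B) ⟩
    join (act⊤ A ᗮ) (join (act⊤ A ᗮ) (act⊤ B) ᗮ)  ≈⟨ join-cong (act⊤-∼ A) (ᗮ-cong act⊤-∼A⊔B) ⟨
    join (act⊤ (P∼ A)) (act⊤ (P⨆ (pair (P∼ A) B)) ᗮ)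
                                                  ≈⟨ join-cong Eq.refl (act⊤-∼ (P⨆ (pair (P∼ A) B))) ⟨
    join (act⊤ (P∼ A)) (act⊤ (P∼ (P⨆ (pair (P∼ A) B))))
                                                  ≈⟨ act-⊔ (P∼ A) (P∼ (P⨆ (pair (P∼ A) B))) top ⟨
    act⊤ (P⨆ (pair (P∼ A) (P∼ (P⨆ (pair (P∼ A) B))))) ∎)
    where
      open Relation.Binary.Reasoning.Setoid setoid
      act⊤-∼A⊔B : act⊤ (P⨆ (pair (P∼ A) B)) ≈ join (act⊤ A ᗮ) (act⊤ B)
      act⊤-∼A⊔B = Eq.trans (act-⊔ (P∼ A) B top) (join-cong (act⊤-∼ A) Eq.refl)

  isIDA : IsIDA (PPre N L)
  isIDA = record
    { ≤-isPartialOrder = record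
      { isPreorder = record
        { isEquivalence = ≈P-isEquivalence
        ; reflexive = λ A≈B → ⊆⇒≤ (proj₁ A≈B)
        ; trans = λ A≤B B≤C → ⊆⇒≤ (λ f p → ≤⇒⊆ B≤C f (≤⇒⊆ A≤B f p)) }
      ; antisym = λ A≤B B≤A → ≤⇒⊆ A≤B , ≤⇒⊆ B≤A }
    ; ⨆-upper = λ F i → ⊆⇒≤ (λ f p → i , p)
    ; ⨆-least = λ F U F≤U → ⊆⇒≤ (λ { f (i , p) → ≤⇒⊆ (F≤U i) f p })
    ; ⨆-cong = λ F≈G → (λ { f (i , p) → i , proj₁ (F≈G i) f p }) , (λ { f (i , p) → i , proj₂ (F≈G i) f p })
    ; ⊙-cong = λ A≈A' B≈B' →
        (λ { f (a , b , pa , pb , q) → a , b , proj₁ A≈A' a pa , proj₁ B≈B' b pb , q }) ,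
        (λ { f (a , b , pa , pb , q) → a , b , proj₂ A≈A' a pa , proj₂ B≈B' b pb , q })
    ; *-cong = λ A≈B → (λ { f (a , pa , q) → a , proj₁ A≈B a pa , q }) ,
                       (λ { f (a , pa , q) → a , proj₂ A≈B a pa , q })
    ; ∼-cong = λ {A} {B} A≈B → P∼-cong A B (act-cong A B A≈B top)
    ; ⊙-assoc = P⊙-assoc
    ; ⊙-distribˡ = λ A F →
        (λ { h (a , b , pa , (i , pb) , q) → i , a , b , pa , pb , q }) ,
        (λ { h (i , a , b , pa , pb , q) → a , b , pa , (i , pb) , q })
    ; ⊙-distribʳ = λ A F →
        (λ { h (a , b , (i , pa) , pb , q) → i , a , b , pa , pb , q }) ,
        (λ { h (i , a , b , pa , pb , q) → a , b , (i , pa) , pb , q })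
    ; ⊙-identityˡ = P⊙-identityˡ
    ; ⊙-identityʳ = P⊙-identityʳ
    ; *-involutive = P*-involutive
    ; *-antihom = P*-antihom
    ; *-⨆ = λ F → (λ { h (a , (i , pa) , q) → i , a , pa , q }) , (λ { h (i , a , pa , q) → a , (i , pa) , q })
    ; ida1 = P∼-⊙-∼∼
    ; ida2 = P∼-⨆-∼∼
    ; ida3 = P∼-selfadjoint
    ; ida4 = P∼-orthomodular
    }

  open PreIDA (PPre N L) using (Tilde; IsTilde; _≈̃_; _≼̃_; _ᗮ̃; _•_; _≡ᴷ_; bullet)

  tilde≈Sπ : ∀ A → IsTilde A → A ≈P Sπ (act⊤ A)
  tilde≈Sπ A (K , A≈∼K) = begin
    A                  ≈⟨ A≈∼K ⟩
    P∼ K               ≈⟨ ∼≈Sπ K ⟩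
    Sπ (act⊤ (P∼ K))   ≈⟨ Sπ-cong (act-cong A (P∼ K) A≈∼K top) ⟨
    Sπ (act⊤ A)        ∎
    where open ≈P-Reasoning

  ≈̃⇔act⊤≈ : ∀ {v w} → (v ≈̃ w) ⇔ (act⊤ (proj₁ v) ≈ act⊤ (proj₁ w))
  ≈̃⇔act⊤≈ {V , tV} {W , tW} = (λ V≈W → act-cong V W V≈W top) , λ eq → begin
    V             ≈⟨ tilde≈Sπ V tV ⟩
    Sπ (act⊤ V)   ≈⟨ Sπ-cong eq ⟩
    Sπ (act⊤ W)   ≈⟨ tilde≈Sπ W tW ⟨
    W             ∎
    where open ≈P-Reasoning

  ≼̃⇔act⊤≤ : ∀ {v w} → (v ≼̃ w) ⇔ (act⊤ (proj₁ v) ≤ act⊤ (proj₁ w))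
  ≼̃⇔act⊤≤ {V , tV} {W , tW} =
    (λ V∨W≈W → trans join-l (reflexive (Eq.trans (Eq.sym act⊤-V∨W) (act-cong (P∼ (P∼ (P⨆ (pair V W)))) W V∨W≈W top)))) ,
    λ V≤W → begin
      P∼ (P∼ (P⨆ (pair V W)))   ≈⟨ ∼∼≈Sπ (P⨆ (pair V W)) ⟩
      Sπ (act⊤ (P⨆ (pair V W))) ≈⟨ Sπ-cong (Eq.trans (act-⊔ V W top) (antisym (join-least V≤W refl) join-r)) ⟩
      Sπ (act⊤ W)               ≈⟨ tilde≈Sπ W tW ⟨
      W                         ∎
    where
      open ≈P-Reasoning
      act⊤-V∨W : act⊤ (P∼ (P∼ (P⨆ (pair V W)))) ≈ join (act⊤ V) (act⊤ W)
      act⊤-V∨W = Eq.trans (act⊤-∼∼ (P⨆ (pair V W))) (act-⊔ V W top)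

  ⋁̃ : {I : Set ι} → (I → Tilde) → Tilde
  ⋁̃ F = P∼ (P∼ U) , P∼ U , Setoid.refl P-setoid {P∼ (P∼ U)}
    where U = P⨆ (λ i → proj₁ (F i))

  semiFoulis : SemiFoulis (PPre N L)
  semiFoulis = InducedCompleteOML.isCompleteOML N _≈̃_ _≼̃_ _ᗮ̃ ⋁̃ (λ w → act⊤ (proj₁ w))
    (λ {v} {w} → ≈̃⇔act⊤≈ {v} {w}) (λ {v} {w} → ≼̃⇔act⊤≤ {v} {w})
    (λ w → act⊤-∼ (proj₁ w))
    (λ F → Eq.trans (act⊤-∼∼ (P⨆ (λ i → proj₁ (F i)))) (act-⨆ (λ i → proj₁ (F i)) top))

  SameSubset⇒⨆≈ : ∀ {I J : Set ι} (S : I → PSub) (S' : J → PSub) →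
                  SameSubset (PPre N L) S S' → P⨆ S ≈P P⨆ S'
  SameSubset⇒⨆≈ S S' (S→S' , S'→S) =
    (λ { f (i , p) → proj₁ (S→S' i) , proj₁ (proj₂ (S→S' i)) f p }) ,
    (λ { f (j , p) → proj₁ (S'→S j) , proj₁ (proj₂ (S'→S j)) f p })

  Sπ-isTilde : ∀ z → IsTilde (Sπ z)
  Sπ-isTilde z = Sπ (z ᗮ) , Sπ-cong (Eq.trans (Eq.sym (ᗮ-involutive z)) (ᗮ-cong (Eq.sym (act⊤-Sπ (z ᗮ)))))

  act⊤-• : ∀ A W → act⊤ (A • W) ≈ act A (act⊤ W)
  act⊤-• A W = Eq.trans (act⊤-∼∼ (A P⊙ W)) (act-⊙ A W top)

  ≡ᴷ⇔act≈ : ∀ {A B} → (A ≡ᴷ B) ⇔ (∀ z → act A z ≈ act B z)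
  ≡ᴷ⇔act≈ {A} {B} = act≈ , λ A≈B W tW → proj₂ (≈̃⇔act⊤≈ {bullet A (W , tW)} {bullet B (W , tW)}) (begin
    act⊤ (A • W)     ≈⟨ act⊤-• A W ⟩
    act A (act⊤ W)   ≈⟨ A≈B (act⊤ W) ⟩
    act B (act⊤ W)   ≈⟨ act⊤-• B W ⟨
    act⊤ (B • W)     ∎)
    where
      open Relation.Binary.Reasoning.Setoid setoid
      act≈ : A ≡ᴷ B → ∀ z → act A z ≈ act B z
      act≈ A≡B z = begin
        act A z                 ≈⟨ act-congʳ A (act⊤-Sπ z) ⟨
        act A (act⊤ (Sπ z))     ≈⟨ act⊤-• A (Sπ z) ⟨
        act⊤ (A • Sπ z)         ≈⟨ act-cong (A • Sπ z) (B • Sπ z) (A≡B (Sπ z) (Sπ-isTilde z)) top ⟩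
        act⊤ (B • Sπ z)         ≈⟨ act⊤-• B (Sπ z) ⟩
        act B (act⊤ (Sπ z))     ≈⟨ act-congʳ B (act⊤-Sπ z) ⟩
        act B z                 ∎

module TPowerSetProperties {ι} (𝒯 : TFunctor ι) (M : CompleteOML ι ι ι) where
  open CompleteOML M
  open CompleteOMLProperties M using (module Eq)
  open LinOps M
  open PowerOps M (L𝒯 𝒯 M)
  open PSub
  open PowerSetProperties M (L𝒯 𝒯 M)
  open TFunctor 𝒯 using (T; T3)
  open SingIso (T3 M)

  K : PreIDA ι (Level.suc ι) ι
  K = PPre M (L𝒯 𝒯 M)

  ⨆-singletons : ∀ A → P⨆ (λ (a : Σ (LinMap M) (mem A)) → singleton (proj₁ a) (mem-L A (proj₂ a))) ≈P A
  ⨆-singletons A = (λ { f ((a , pa) , f≈a) → mem-resp A (λ z → Eq.sym (f≈a z)) pa }) ,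
                   (λ f pf → (f , pf) , (λ z → Eq.refl))

  T-inhabited : ∀ {A} → T K A → Σ (LinMap M) (mem A)
  T-inhabited {A} TA = let (a , _ , A≈a) = sing-surj A TA in a , proj₂ A≈a a (λ z → Eq.refl)

  T-act : ∀ {A f} → T K A → mem A f → ∀ z → act A z ≈ LinMap.fun f z
  T-act {A} {f} TA pf z =
    let (a , la , A≈a) = sing-surj A TA in Eq.trans (act-≈singleton A a la A≈a z) (Eq.sym (proj₁ A≈a f pf z))

  T-act-injective : ∀ {A B} → T K A → T K B → (∀ z → act A z ≈ act B z) → A ≈P B
  T-act-injective {A} {B} TA TB A≈B =
    let (a , la , A≈a) = sing-surj A TA
        (b , lb , B≈b) = sing-surj B TB
        a≈b : a ≈L b
        a≈b z = Eq.trans (Eq.sym (act-≈singleton A a la A≈a z))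
                  (Eq.trans (A≈B z) (act-≈singleton B b lb B≈b z))
    in begin
      A                ≈⟨ A≈a ⟩
      singleton a la   ≈⟨ singleton-cong la lb a≈b ⟩
      singleton b lb   ≈⟨ B≈b ⟨
      B                ∎
    where open ≈P-Reasoning

  T-shared-member : ∀ {A B f} → T K A → T K B → mem A f → mem B f → A ≈P B
  T-shared-member TA TB pA pB = T-act-injective TA TB λ z → Eq.trans (T-act TA pA z) (Eq.sym (T-act TB pB z))

  ⨆-T-⊆⇒≈ : ∀ {I J : Set ι} (S : I → PSub) (S' : J → PSub) → (∀ i → T K (S i)) → (∀ j → T K (S' j)) →
            P⨆ S ⊆ P⨆ S' → ∀ i → Σ J λ j → S i ≈P S' j
  ⨆-T-⊆⇒≈ S S' TS TS' S⊆S' i =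
    let (f , f∈Si) = T-inhabited (TS i)
        (j , f∈S'j) = S⊆S' f (i , f∈Si)
    in j , T-shared-member (TS i) (TS' j) f∈Si f∈S'j

lemma5p1 : ∀ {ι : Level} (𝒯 : TFunctor ι) (M : CompleteOML ι ι ι) →
    IsTODA 𝒯 (PPre M (L𝒯 𝒯 M))
lemma5p1 𝒯 M = record
  { isIDA = isIDA
  ; toda1 = semiFoulis
  ; toda2 = λ A A-resp A-T _ _ A-⨆ X →
      A-resp (⨆-singletons X) (A-⨆ _ λ (f , f∈X) → A-T _ (sing-T f (mem-L X f∈X)))
  ; toda3 = λ S S' TS TS' →
      (λ (S⊆S' , S'⊆S) → ⨆-T-⊆⇒≈ S S' TS TS' S⊆S' , ⨆-T-⊆⇒≈ S' S TS' TS S'⊆S) ,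
      SameSubset⇒⨆≈ S S'
  ; toda4 = λ s t Ts Tt →
      (λ s≈t → proj₂ (≡ᴷ⇔act≈ {s} {t}) (act-cong s t s≈t)) ,
      (λ s≡t → T-act-injective Ts Tt (proj₁ (≡ᴷ⇔act≈ {s} {t}) s≡t))
  }
  where
    open TPowerSetProperties 𝒯 M
    open PowerSetProperties M (L𝒯 𝒯 M)
    open PowerOps.PSub using (mem-L)
    open TFunctor 𝒯 using (T3)
    open SingIso (T3 M) using (sing-T)
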